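{- Let $b\ge2$ be an integer and let $k,r,y$ be nonnegative integers with $2y<r<k-1$. If $a_ta_{t-1}\cdots a_0$ is the ordinary base $b$ expansion of $\nu(k,r,y)-1$, then $t=k$, $a_k=1$, $a_0=0$, $a_j=0$ for all $j\in\{r+1,\ldots,k-1\}$, and $a_i\in\{0,1\}$ for all $i\in\{0,1,\ldots,k\}$.
   Context: Fix an integer $b\ge 2$. A base $b$ over-expansion of a positive integer $N$ is a word $d_kd_{k-1}\cdots d_0$ over $\{0,1,\ldots,b\}$ with $d_k\neq 0$ and $\sum_{i=0}^k d_ib^i=N$; the ordinary base $b$ expansion is the unique one using only digits $0,\dots,b-1$. For $n\ge 2$, $s_b(n)$ is the number of base $b$ over-expansions of $n-1$; $s_b(0)=0$, $s_b(1)=1$. For nonnegative integers $k,r,y$: $I(k,r,y)=\{n\in\mathbb N: b^k<n\le b^k+\sum_{i=0}^y b^{r-2i}\}$, $\mu(k,r,y)=\max\{s_b(n):n\in I(k,r,y)\}$, and $\nu(k,r,y)=\min\{n\in I(k,r,y): s_b(n)=\mu(k,r,y)\}$. -}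

module Defs where

open import Data.Nat using (ℕ; zero; suc; _+_; _*_; _∸_; _^_; _≤_; _<_; _≤ᵇ_; _≡ᵇ_)
open import Data.Bool using (Bool; true; false; _∧_; not)
open import Data.List using (List; []; _∷_; length; filter; map; concatMap; upTo; applyUpTo)
open import Data.Product using (_×_)
open import Relation.Binary.PropositionalEquality using (_≡_)
open import Relation.Nullary using (¬_)
open import Relation.Nullary.Decidable using (Dec; yes; no)
open import Data.Bool using (T)

sumTo : ℕ → (ℕ → ℕ) → ℕ
sumTo zero    f = f 0
sumTo (suc t) f = sumTo t f + f (suc t)

-- Words are little-endian digit lists d₀ ∷ d₁ ∷ … ∷ d_k.
-- value b (d₀ ∷ … ∷ d_k) = Σ dᵢ bⁱ
value : ℕ → List ℕ → ℕ
value b []       = 0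
value b (d ∷ ds) = d + b * value b ds

words : ℕ → ℕ → List (List ℕ)
words b zero    = [] ∷ []
words b (suc L) = concatMap (λ d → map (d ∷_) (words b L)) (upTo (suc b))

leadNonzero : List ℕ → Bool
leadNonzero []           = false
leadNonzero (d ∷ [])     = not (d ≡ᵇ 0)
leadNonzero (d ∷ e ∷ ds) = leadNonzero (e ∷ ds)

-- is ds a base-b over-expansion of N (digits in {0..b} guaranteed by `words`)
isOverExp : ℕ → ℕ → List ℕ → Bool
isOverExp b N ds = leadNonzero ds ∧ (value b ds ≡ᵇ N)

countLen : ℕ → ℕ → ℕ → ℕ
countLen b N L = length (filter (λ ds → T? (isOverExp b N ds)) (words b L))
  where
  T? : (x : Bool) → Dec (T x)
  T? true  = yes _
  T? false = no (λ ())

-- number of base-b over-expansions of N.  An over-expansion d_k…d₀ of N ≥ 1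
-- has b^k ≤ N, hence k + 1 ≤ N, so lengths 1..N cover all of them.
countOverExp : ℕ → ℕ → ℕ
countOverExp b N = go N
  where
  go : ℕ → ℕ
  go zero    = 0
  go (suc L) = go L + countLen b N (suc L)

s : ℕ → ℕ → ℕ
s b zero          = 0
s b (suc zero)    = 1
s b (suc (suc m)) = countOverExp b (suc m)

upper : ℕ → ℕ → ℕ → ℕ → ℕ
upper b k r y = b ^ k + sumTo y (λ i → b ^ (r ∸ 2 * i))

InI : ℕ → ℕ → ℕ → ℕ → ℕ → Set
InI b k r y n = (b ^ k < n) × (n ≤ upper b k r y)

IsNu : ℕ → ℕ → ℕ → ℕ → ℕ → Set
IsNu b k r y n =
  InI b k r y n ×
  ((m : ℕ) → InI b k r y m → s b m ≤ s b n) ×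
  ((m : ℕ) → InI b k r y m → m < n → s b m < s b n)

-- a_t a_{t-1} … a_0 is the ordinary base-b expansion of N
-- (digits given as a function a : ℕ → ℕ, only a 0 … a t are relevant)
IsBaseExp : ℕ → ℕ → ℕ → (ℕ → ℕ) → Set
IsBaseExp b N t a =
  ((i : ℕ) → i ≤ t → a i < b) ×
  ¬ (a t ≡ 0) ×
  (sumTo t (λ i → a i * b ^ i) ≡ N)

-- Write N = ν(k,r,y) − 1 and let e_ℓ(N) be the number of ℓ-digit over-expansions of N, so
-- that s_b(N + 1) = Σ_ℓ e_ℓ(N).  The interval gives b^k ≤ N < b^k + b^(r+1); this alone forces
-- t = k, a_k = 1 and a_j = 0 for r < j < k.  Splitting off the last digit gives
-- e_(ℓ+1)(x + bq) = e_ℓ(q) for 0 < x < b and e_(ℓ+1)(bq) = e_ℓ(q) + e_ℓ(q − 1).  With these one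
-- checks, length by length, that clearing a nonzero last digit of N, or lowering a digit a_i ≥ 2
-- to 1, gives a smaller M ≥ b^k with e_ℓ(M) ≥ e_ℓ(N) for every ℓ, hence s_b(M + 1) ≥ s_b(N + 1),
-- contradicting the choice of ν as the least maximiser.
module Submission where

open import Defs
open import Data.Nat using (ℕ; _+_; _*_; _∸_; _≤_; _<_)
open import Data.Product using (_×_)
open import Relation.Binary.PropositionalEquality using (_≡_)
open import Data.Nat using (zero; suc; pred; _^_; _≡ᵇ_; _≟_; _≤?_; z≤n; s≤s; z<s)
open import Data.Nat using (NonZero; >-nonZero; >-nonZero⁻¹; ≢-nonZero)
open import Data.Nat.Properties
open import Data.Nat.DivMod using (_/_; _%_; m≡m%n+[m/n]*n; m%n<n; m/n*n≤m)
open import Data.Nat.Tactic.RingSolver using (solve-∀)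
open import Data.Bool using (Bool; true; false; _∧_; T; if_then_else_)
open import Data.Bool.Properties using (∧-zeroʳ; ¬-not)
open import Data.List using (List; []; _∷_; length; filter; map; concatMap; applyUpTo; _++_)
open import Data.Product using (_,_; proj₁; proj₂; Σ-syntax)
open import Data.Sum using (inj₁; inj₂)
open import Data.Unit using (tt)
open import Function using (_∘_; _∘′_)
open import Relation.Binary.Definitions using (tri<; tri≈; tri>)
open import Relation.Binary.PropositionalEquality
  using (_≢_; refl; sym; trans; cong; cong₂; subst; subst₂; module ≡-Reasoning)
open import Relation.Nullary using (Dec; yes; no; ¬_; contradiction)
open import Relation.Nullary.Decidable using (dec-true; dec-false)

sumBelow : ℕ → (ℕ → ℕ) → ℕ
sumBelow zero    f = 0
sumBelow (suc n) f = sumBelow n f + f n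

syntax sumBelow n (λ i → e) = ∑[ i < n ] e

sumTo≡sumBelow : ∀ t f → sumTo t f ≡ sumBelow (suc t) f
sumTo≡sumBelow zero    f = refl
sumTo≡sumBelow (suc t) f = cong (_+ f (suc t)) (sumTo≡sumBelow t f)

sumBelow-unique : ∀ {g f : ℕ → ℕ} → g 0 ≡ 0 → (∀ n → g (suc n) ≡ g n + f n) →
                  ∀ n → g n ≡ sumBelow n f
sumBelow-unique g0 gsuc zero    = g0
sumBelow-unique g0 gsuc (suc n) = trans (gsuc n) (cong (_+ _) (sumBelow-unique g0 gsuc n))

sumBelow-head : ∀ n f → sumBelow (suc n) f ≡ f 0 + sumBelow n (f ∘ suc)
sumBelow-head zero    f = +-comm 0 (f 0)
sumBelow-head (suc n) f = trans (cong (_+ f (suc n)) (sumBelow-head n f)) (+-assoc (f 0) _ _)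

sumBelow-cong : ∀ n {f g} → (∀ {i} → i < n → f i ≡ g i) → sumBelow n f ≡ sumBelow n g
sumBelow-cong zero    eq = refl
sumBelow-cong (suc n) eq = cong₂ _+_ (sumBelow-cong n (eq ∘ m<n⇒m<1+n)) (eq ≤-refl)

sumBelow-zero : ∀ n {f} → (∀ {i} → i < n → f i ≡ 0) → sumBelow n f ≡ 0
sumBelow-zero zero    eq = refl
sumBelow-zero (suc n) eq = cong₂ _+_ (sumBelow-zero n (eq ∘ m<n⇒m<1+n)) (eq ≤-refl)

sumBelow-single : ∀ n {f j} → j < n → (∀ {i} → i < n → i ≢ j → f i ≡ 0) →
                  sumBelow n f ≡ f j
sumBelow-single (suc n) {f} {j} j<1+n others with j ≟ n
... | yes refl = cong (_+ f j) (sumBelow-zero n (λ i<n → others (m<n⇒m<1+n i<n) (<⇒≢ i<n)))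
... | no j≢n   = begin
  sumBelow n f + f n ≡⟨ cong₂ _+_ (sumBelow-single n j<n (others ∘ m<n⇒m<1+n))
                                  (others ≤-refl (j≢n ∘ sym)) ⟩
  f j + 0            ≡⟨ +-identityʳ (f j) ⟩
  f j                ∎
  where
  open ≡-Reasoning
  j<n : j < n
  j<n = ≤∧≢⇒< (≤-pred j<1+n) j≢n

sumBelow-mono-≤ : ∀ n {f g} → (∀ i → f i ≤ g i) → sumBelow n f ≤ sumBelow n g
sumBelow-mono-≤ zero    le = z≤n
sumBelow-mono-≤ (suc n) le = +-mono-≤ (sumBelow-mono-≤ n le) (le n)

sumBelow-vanishing : ∀ m j {f} → (∀ {i} → m ≤ i → f i ≡ 0) → sumBelow (m + j) f ≡ sumBelow m f
sumBelow-vanishing m zero    eq = cong (λ n → sumBelow n _) (+-identityʳ m)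
sumBelow-vanishing m (suc j) eq rewrite +-suc m j =
  trans (cong₂ _+_ (sumBelow-vanishing m j eq) (eq (m≤m+n m j))) (+-identityʳ _)

count : {A : Set} → (A → Bool) → List A → ℕ
count p []       = 0
count p (x ∷ xs) = (if p x then 1 else 0) + count p xs

module _ {A : Set} where

  length-filter≡count : (p : A → Bool) (P? : ∀ x → Dec (T (p x))) (xs : List A) →
                        length (filter P? xs) ≡ count p xs
  length-filter≡count p P? []       = refl
  length-filter≡count p P? (x ∷ xs) with p x | P? x
  ... | true  | yes _  = cong suc (length-filter≡count p P? xs)
  ... | true  | no ¬px = contradiction tt ¬px
  ... | false | no _   = length-filter≡count p P? xs

  count-++ : ∀ p (xs ys : List A) → count p (xs ++ ys) ≡ count p xs + count p ys
  count-++ p []       ys = refl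
  count-++ p (x ∷ xs) ys =
    trans (cong (_ +_) (count-++ p xs ys)) (sym (+-assoc (if p x then 1 else 0) (count p xs) _))

  count-map : ∀ {B : Set} p (f : B → A) xs → count p (map f xs) ≡ count (p ∘ f) xs
  count-map p f []       = refl
  count-map p f (x ∷ xs) = cong (_ +_) (count-map p f xs)

  count-cong : ∀ {p q} → (∀ x → p x ≡ q x) → ∀ (xs : List A) → count p xs ≡ count q xs
  count-cong eq []       = refl
  count-cong eq (x ∷ xs) = cong₂ (λ c n → (if c then 1 else 0) + n) (eq x) (count-cong eq xs)

  count-false : ∀ {p} → (∀ x → p x ≡ false) → ∀ (xs : List A) → count p xs ≡ 0
  count-false eq []       = refl
  count-false eq (x ∷ xs) rewrite eq x = count-false eq xs

  count-concatMap : ∀ {B : Set} p (G : B → List A) (g : ℕ → B) n →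
                    count p (concatMap G (applyUpTo g n)) ≡ ∑[ i < n ] count p (G (g i))
  count-concatMap p G g zero    = refl
  count-concatMap p G g (suc n) = begin
    count p (G (g 0) ++ concatMap G (applyUpTo (g ∘ suc) n))
      ≡⟨ count-++ p (G (g 0)) _ ⟩
    count p (G (g 0)) + count p (concatMap G (applyUpTo (g ∘ suc) n))
      ≡⟨ cong (_ +_) (count-concatMap p G (g ∘ suc) n) ⟩
    count p (G (g 0)) + ∑[ i < n ] count p (G (g (suc i)))
      ≡⟨ sumBelow-head n (λ i → count p (G (g i))) ⟨
    ∑[ i < suc n ] count p (G (g i)) ∎
    where open ≡-Reasoning

count-words-suc : ∀ b L p →
  count p (words b (suc L)) ≡ ∑[ d < suc b ] count (p ∘ (d ∷_)) (words b L)
count-words-suc b L p = trans (count-concatMap p (λ d → map (d ∷_) (words b L)) (λ d → d) (suc b))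
  (sumBelow-cong (suc b) (λ {d} _ → count-map p (d ∷_) (words b L)))

-- The recursive helper `go` of countOverExp is local to Defs and cannot be named.  Abstracting
-- `suc M` separates go's fixed parameter from its recursion argument M, and the resulting
-- equation is a pattern that determines the meta `go` below to be exactly that helper.
mutual
  private
    go : ℕ → ℕ → ℕ → ℕ
    go = _

  countOverExp≡sumBelow : ∀ b N → countOverExp b N ≡ ∑[ L < N ] countLen b N (suc L)
  countOverExp≡sumBelow b zero    = refl
  countOverExp≡sumBelow b (suc M) with suc M
  ... | N = cong (_+ countLen b N (suc M)) (sumBelow-unique {g = go b N} refl (λ _ → refl) M)

≡ᵇ-false : ∀ {m n} → m ≢ n → (m ≡ᵇ n) ≡ false
≡ᵇ-false {m} {n} = dec-false (m ≟ n)

≡ᵇ-cong : ∀ {m n m' n'} → (m ≡ n → m' ≡ n') → (m' ≡ n' → m ≡ n) →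
          (m ≡ᵇ n) ≡ (m' ≡ᵇ n')
≡ᵇ-cong {m} {n} {m'} {n'} to from with m ≟ n
... | yes m≡n = trans (dec-true (m ≟ n) m≡n) (sym (dec-true (m' ≟ n') (to m≡n)))
... | no m≢n  = trans (dec-false (m ≟ n) m≢n) (sym (dec-false (m' ≟ n') (m≢n ∘ from)))

pred[m*suc[n]] : ∀ m n → 0 < m → pred (m * suc n) ≡ pred m + m * n
pred[m*suc[n]] (suc m) n _ = cong pred (*-suc (suc m) n)

m*n≤o+m*p⇒n≤p : ∀ {m n o p} → o < m → m * n ≤ o + m * p → n ≤ p
m*n≤o+m*p⇒n≤p {m} {n} {o} {p} o<m m*n≤o+m*p = ≤-pred (*-cancelˡ-< m n (suc p) (begin-strict
  m * n     ≤⟨ m*n≤o+m*p ⟩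
  o + m * p <⟨ +-monoˡ-< (m * p) o<m ⟩
  m + m * p ≡⟨ *-suc m p ⟨
  m * suc p ∎))
  where open ≤-Reasoning

m<n∸1⇒1+m<n : ∀ {m n} → m < n ∸ 1 → suc m < n
m<n∸1⇒1+m<n {n = suc n} m<n∸1 = s≤s m<n∸1

split-last-digit : ∀ x X b B A → (x + X * b) + (b * B) * A ≡ x + b * (X + B * A)
split-last-digit = solve-∀

absorb-top-digit : ∀ X B c b Y d P →
  (X + B * (c + b * Y)) + d * (P * (b * B)) ≡ X + B * (c + b * (Y + d * P))
absorb-top-digit = solve-∀

regroup-digit : ∀ X B c b Y → X + B * (c + b * Y) ≡ (X + c * B) + (b * B) * Y
regroup-digit = solve-∀

module _ (b : ℕ) where

  digit+b*-< : ∀ {d x v q} → d < b → v < q → d + b * v < x + b * q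
  digit+b*-< {d} {x} {v} {q} d<b v<q = begin-strict
    d + b * v <⟨ +-monoˡ-< (b * v) d<b ⟩
    b + b * v ≡⟨ *-suc b v ⟨
    b * suc v ≤⟨ *-monoʳ-≤ b v<q ⟩
    b * q     ≤⟨ m≤n+m (b * q) x ⟩
    x + b * q ∎
    where open ≤-Reasoning

  digit+b*-injective : ∀ {d x v q} → d < b → x < b → d + b * v ≡ x + b * q → d ≡ x × v ≡ q
  digit+b*-injective {d} {x} {v} {q} d<b x<b eq with <-cmp v q
  ... | tri< v<q _ _  = contradiction eq (<⇒≢ (digit+b*-< d<b v<q))
  ... | tri≈ _ refl _ = +-cancelʳ-≡ (b * v) d x eq , refl
  ... | tri> _ _ q<v  = contradiction (sym eq) (<⇒≢ (digit+b*-< x<b q<v))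

  isOverExpWhere : (ℕ → Bool) → List ℕ → Bool
  isOverExpWhere Q ds = leadNonzero ds ∧ Q (value b ds)

  countLenWhere : (ℕ → Bool) → ℕ → ℕ
  countLenWhere Q L = count (isOverExpWhere Q) (words b L)

  countLen≡countLenWhere : ∀ N L → countLen b N L ≡ countLenWhere (_≡ᵇ N) L
  countLen≡countLenWhere N L = length-filter≡count _ _ (words b L)

  countLenWhere-cong : ∀ {Q Q'} L → (∀ v → Q v ≡ Q' v) → countLenWhere Q L ≡ countLenWhere Q' L
  countLenWhere-cong L eq = count-cong (λ ds → cong (leadNonzero ds ∧_) (eq (value b ds))) (words b L)

  countLenWhere-never : ∀ {Q} L → (∀ v → Q v ≡ false) → countLenWhere Q L ≡ 0
  countLenWhere-never L never =
    count-false (λ ds → trans (cong (leadNonzero ds ∧_) (never _)) (∧-zeroʳ _)) (words b L)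

  countLenWhere-suc : ∀ Q L →
    countLenWhere Q (2 + L) ≡ ∑[ d < suc b ] countLenWhere (λ v → Q (d + b * v)) (suc L)
  countLenWhere-suc Q L =
    trans (count-words-suc b (suc L) (isOverExpWhere Q)) (sumBelow-cong (suc b) λ {d} _ →
      trans (count-words-suc b L _) (sym (count-words-suc b L (isOverExpWhere (λ v → Q (d + b * v))))))

  countLenWhere-1 : ∀ Q → (∀ d → 0 < d → d ≤ b → Q d ≡ false) → countLenWhere Q 1 ≡ 0
  countLenWhere-1 Q never =
    trans (count-words-suc b 0 (isOverExpWhere Q))
          (sumBelow-zero (suc b) λ d<1+b → one-digit _ (≤-pred d<1+b))
    where
    one-digit : ∀ d → d ≤ b → (if leadNonzero (d ∷ []) ∧ Q (d + b * 0) then 1 else 0) + 0 ≡ 0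
    one-digit zero    _   = refl
    one-digit (suc d) d≤b rewrite *-zeroʳ b | +-identityʳ d | never (suc d) z<s d≤b = refl

  countLenWhere-below : ∀ Q L → (∀ v → Q v ≡ true → v < b ^ L) → countLenWhere Q (suc L) ≡ 0
  countLenWhere-below Q zero    small =
    countLenWhere-1 Q λ { (suc d) _ _ → ¬-not λ Qd → contradiction (small (suc d) Qd) λ { (s≤s ()) } }
  countLenWhere-below Q (suc L) small = trans (countLenWhere-suc Q L) (sumBelow-zero (suc b) λ {d} _ →
    countLenWhere-below _ L λ v Qv → *-cancelˡ-< b v (b ^ L) (≤-<-trans (m≤n+m (b * v) d) (small _ Qv)))

  ∑-digits : ∀ {x q} L → x < b →
    ∑[ d < b ] countLenWhere (λ v → d + b * v ≡ᵇ x + b * q) (suc L) ≡ countLen b q (suc L)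
  ∑-digits {x} {q} L x<b = begin
    ∑[ d < b ] countLenWhere (λ v → d + b * v ≡ᵇ x + b * q) (suc L)
      ≡⟨ sumBelow-single b x<b (λ d<b d≢x → countLenWhere-never (suc L) λ v →
           ≡ᵇ-false {_ + b * v} {x + b * q} (d≢x ∘ proj₁ ∘ digit+b*-injective d<b x<b)) ⟩
    countLenWhere (λ v → x + b * v ≡ᵇ x + b * q) (suc L)
      ≡⟨ countLenWhere-cong (suc L) (λ v →
           ≡ᵇ-cong {x + b * v} {x + b * q} {v} {q}
             (proj₂ ∘ digit+b*-injective x<b x<b) (cong (λ w → x + b * w))) ⟩
    countLenWhere (_≡ᵇ q) (suc L)
      ≡⟨ countLen≡countLenWhere q (suc L) ⟨
    countLen b q (suc L) ∎
    where open ≡-Reasoning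

  countLen-nonzero-last : ∀ {x q} L → 0 < x → x < b →
    countLen b (x + b * q) (2 + L) ≡ countLen b q (suc L)
  countLen-nonzero-last {x} {q} L 0<x x<b = begin
    countLen b (x + b * q) (2 + L)
      ≡⟨ trans (countLen≡countLenWhere (x + b * q) (2 + L)) (countLenWhere-suc (_≡ᵇ x + b * q) L) ⟩
    ∑[ d < b ] countLenWhere (λ v → d + b * v ≡ᵇ x + b * q) (suc L)
      + countLenWhere (λ v → b + b * v ≡ᵇ x + b * q) (suc L)
      ≡⟨ cong₂ _+_ (∑-digits L x<b) (countLenWhere-never (suc L) λ v →
           ≡ᵇ-false {b + b * v} {x + b * q} λ eq →
             <⇒≢ 0<x (proj₁ (digit+b*-injective (<-trans 0<x x<b) x<b (trans (*-suc b v) eq)))) ⟩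
    countLen b q (suc L) + 0
      ≡⟨ +-identityʳ _ ⟩
    countLen b q (suc L) ∎
    where open ≡-Reasoning

  countLen-zero-last : ∀ q L → .{{NonZero b}} →
    countLen b (b * suc q) (2 + L) ≡ countLen b (suc q) (suc L) + countLen b q (suc L)
  countLen-zero-last q L = begin
    countLen b (b * suc q) (2 + L)
      ≡⟨ trans (countLen≡countLenWhere (b * suc q) (2 + L)) (countLenWhere-suc (_≡ᵇ b * suc q) L) ⟩
    ∑[ d < b ] countLenWhere (λ v → d + b * v ≡ᵇ b * suc q) (suc L)
      + countLenWhere (λ v → b + b * v ≡ᵇ b * suc q) (suc L)
      ≡⟨ cong₂ _+_ (∑-digits L 0<b) (countLenWhere-cong (suc L) λ v →
           ≡ᵇ-cong {b + b * v} {b * suc q} {v} {q}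
             (λ eq → suc-injective (proj₂ (digit+b*-injective 0<b 0<b (trans (*-suc b v) eq))))
             (λ { refl → sym (*-suc b q) })) ⟩
    countLen b (suc q) (suc L) + countLenWhere (_≡ᵇ q) (suc L)
      ≡⟨ cong (countLen b (suc q) (suc L) +_) (countLen≡countLenWhere q (suc L)) ⟨
    countLen b (suc q) (suc L) + countLen b q (suc L) ∎
    where
    open ≡-Reasoning
    0<b : 0 < b
    0<b = >-nonZero⁻¹ b

  countLen-1-large : ∀ {N} → b < N → countLen b N 1 ≡ 0
  countLen-1-large {N} b<N = trans (countLen≡countLenWhere N 1) (countLenWhere-1 (_≡ᵇ N) λ d _ d≤b →
    ≡ᵇ-false {d} {N} λ { refl → <⇒≱ b<N d≤b })

module _ (b : ℕ) (a : ℕ → ℕ) where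

  digitsValue : ℕ → ℕ
  digitsValue n = ∑[ i < n ] (a i * b ^ i)

  digitsValue-< : ∀ n → (∀ {i} → i < n → a i < b) → digitsValue n < b ^ n
  digitsValue-< zero    a<b = z<s
  digitsValue-< (suc n) a<b = begin-strict
    digitsValue n + a n * b ^ n   <⟨ +-monoˡ-< _ (digitsValue-< n (a<b ∘′ m<n⇒m<1+n)) ⟩
    suc (a n) * b ^ n             ≤⟨ *-monoˡ-≤ (b ^ n) (a<b ≤-refl) ⟩
    b * b ^ n                     ∎
    where open ≤-Reasoning

  term≤digitsValue : ∀ {i n} → i < n → a i * b ^ i ≤ digitsValue n
  term≤digitsValue {i} {suc n} i<1+n with m≤n⇒m<n∨m≡n (≤-pred i<1+n)
  ... | inj₁ i<n  = ≤-trans (term≤digitsValue i<n) (m≤m+n _ _)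
  ... | inj₂ refl = m≤n+m _ _

  digitsValue-split : ∀ i m → digitsValue (m + suc i) ≡
    digitsValue i + b ^ i * (a i + b * ∑[ j < m ] (a (j + suc i) * b ^ j))
  digitsValue-split i zero    = cong (digitsValue i +_) (begin
    a i * b ^ i           ≡⟨ *-comm (a i) (b ^ i) ⟩
    b ^ i * a i           ≡⟨ cong (b ^ i *_) (+-identityʳ (a i)) ⟨
    b ^ i * (a i + 0)     ≡⟨ cong (λ z → b ^ i * (a i + z)) (*-zeroʳ b) ⟨
    b ^ i * (a i + b * 0) ∎)
    where open ≡-Reasoning
  digitsValue-split i (suc m) = begin
    digitsValue (m + suc i) + a (m + suc i) * b ^ (m + suc i)
      ≡⟨ cong₂ _+_ (digitsValue-split i m) (cong (a (m + suc i) *_) (^-distribˡ-+-* b m (suc i))) ⟩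
    (digitsValue i + b ^ i * (a i + b * Y)) + a (m + suc i) * (b ^ m * (b * b ^ i))
      ≡⟨ absorb-top-digit (digitsValue i) (b ^ i) (a i) b Y (a (m + suc i)) (b ^ m) ⟩
    digitsValue i + b ^ i * (a i + b * (Y + a (m + suc i) * b ^ m)) ∎
    where
    open ≡-Reasoning
    Y : ℕ
    Y = ∑[ j < m ] (a (j + suc i) * b ^ j)

  digitsValue-split′ : ∀ {i n} → i < n →
    Σ[ Y ∈ ℕ ] digitsValue n ≡ digitsValue i + b ^ i * (a i + b * Y)
  digitsValue-split′ {i} {n} i<n =
    _ , trans (cong digitsValue (sym (m∸n+n≡m i<n))) (digitsValue-split i (n ∸ suc i))

IsBaseExp⇒bounds : ∀ {b N t a} → IsBaseExp b N t a → b ^ t ≤ N × N < b ^ suc t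
IsBaseExp⇒bounds {b} {N} {t} {a} (a<b , a[t]≢0 , sum≡N) =
  subst (b ^ t ≤_) value≡N
    (≤-trans (m≤n*m (b ^ t) (a t) {{≢-nonZero a[t]≢0}}) (term≤digitsValue b a (n<1+n t))) ,
  subst (_< b ^ suc t) value≡N (digitsValue-< b a (suc t) (a<b _ ∘′ ≤-pred))
  where
  value≡N : digitsValue b a (suc t) ≡ N
  value≡N = trans (sym (sumTo≡sumBelow t _)) sum≡N

-- ν(k,r,y) − 1 is a record in this sense.
IsRecord : ℕ → ℕ → ℕ → Set
IsRecord b k N = ∀ {M} → b ^ k ≤ M → M < N → countOverExp b M < countOverExp b N

module _ {b : ℕ} (1<b : 1 < b) where

  private
    instance
      b-nonZero : NonZero b
      b-nonZero = >-nonZero (<-trans z<s 1<b)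

    ≡0⇒≤ : ∀ {m n} → m ≡ 0 → m ≤ n
    ≡0⇒≤ m≡0 = subst (_≤ _) (sym m≡0) z≤n

    ≤-resp-≡ : ∀ {m m' n n'} → m ≡ m' → n ≡ n' → m' ≤ n' → m ≤ n
    ≤-resp-≡ refl refl m'≤n' = m'≤n'

  n<b^n : ∀ n → n < b ^ n
  n<b^n zero    = z<s
  n<b^n (suc n) = ≤-trans (s≤s (n<b^n n)) (^-monoʳ-< b 1<b (n<1+n n))

  countLen-small : ∀ {N L} → N ≤ L → countLen b N (suc L) ≡ 0
  countLen-small {N} {L} N≤L = trans (countLen≡countLenWhere b N (suc L))
    (countLenWhere-below b (_≡ᵇ N) L λ v v≡ᵇN →
      ≤-<-trans (≤-trans (≤-reflexive (≡ᵇ⇒≡ v N (subst T (sym v≡ᵇN) tt))) N≤L) (n<b^n L))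

  infix 4 _≼_
  _≼_ : ℕ → ℕ → Set
  N ≼ N' = ∀ L → countLen b N (suc L) ≤ countLen b N' (suc L)

  countOverExp-≤ : ∀ {N N'} → N' ≤ N → N ≼ N' → countOverExp b N ≤ countOverExp b N'
  countOverExp-≤ {N} {N'} N'≤N N≼N' = begin
    countOverExp b N                              ≡⟨ countOverExp≡sumBelow b N ⟩
    ∑[ L < N ] countLen b N (suc L)               ≤⟨ sumBelow-mono-≤ N N≼N' ⟩
    ∑[ L < N ] countLen b N' (suc L)              ≡⟨ cong (λ n → ∑[ L < n ] countLen b N' (suc L))
                                                          (m+[n∸m]≡n N'≤N) ⟨
    ∑[ L < N' + (N ∸ N') ] countLen b N' (suc L)  ≡⟨ sumBelow-vanishing N' (N ∸ N') countLen-small ⟩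
    ∑[ L < N' ] countLen b N' (suc L)             ≡⟨ countOverExp≡sumBelow b N' ⟨
    countOverExp b N'                             ∎
    where open ≤-Reasoning

  countLen-≤-clear-last : ∀ {x q} L → 0 < x → x < b → 0 < q →
    countLen b (x + b * q) (suc L) ≤ countLen b (b * q) (suc L)
  countLen-≤-clear-last {x} {suc q} zero    0<x x<b _ =
    ≡0⇒≤ (countLen-1-large b (<-≤-trans (m<n+m b 0<x) (+-monoʳ-≤ x (m≤m*n b (suc q)))))
  countLen-≤-clear-last {x} {suc q} (suc L) 0<x x<b _ =
    ≤-resp-≡ (countLen-nonzero-last b L 0<x x<b) (countLen-zero-last b q L) (m≤m+n _ _)

  -- Tracking N − 1 alongside N makes the relation stable under appending a digit: a zero last
  -- digit of x + bN contributes the expansions of both N and N − 1 (countLen-zero-last).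
  infix 4 _≤[_]_
  _≤[_]_ : ℕ → ℕ → ℕ → Set
  N ≤[ ℓ ] N' = countLen b N ℓ ≤ countLen b N' ℓ ×
                countLen b (pred N) ℓ ≤ countLen b (pred N') ℓ

  ≤[1]-large : ∀ {N N'} → 2 + b ≤ N → N ≤[ 1 ] N'
  ≤[1]-large {suc N} (s≤s 1+b≤N) =
    ≡0⇒≤ (countLen-1-large b (m<n⇒m<1+n 1+b≤N)) , ≡0⇒≤ (countLen-1-large b 1+b≤N)

  ≤[]-append-digit : ∀ {x M M'} L → x < b → 0 < M → 0 < M' → M ≤[ suc L ] M' →
                     x + b * M ≤[ 2 + L ] x + b * M'
  ≤[]-append-digit {zero} {suc m} {suc m'} L _ _ _ (≤₁ , ≤₀) =
    ≤-resp-≡ (countLen-zero-last b m L) (countLen-zero-last b m' L) (+-mono-≤ ≤₁ ≤₀) ,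
    ≤-resp-≡ (predecessor m) (predecessor m') ≤₀
    where
    predecessor : ∀ n → countLen b (pred (b * suc n)) (2 + L) ≡ countLen b n (suc L)
    predecessor n = trans (cong (λ z → countLen b z (2 + L)) (pred[m*suc[n]] b n (>-nonZero⁻¹ b)))
      (countLen-nonzero-last b L (pred-mono-≤ 1<b) (≤-reflexive (suc-pred b)))
  ≤[]-append-digit {suc zero} {suc m} {suc m'} L _ _ _ (≤₁ , ≤₀) =
    ≤-resp-≡ (countLen-nonzero-last b L z<s 1<b) (countLen-nonzero-last b L z<s 1<b) ≤₁ ,
    ≤-resp-≡ (countLen-zero-last b m L) (countLen-zero-last b m' L) (+-mono-≤ ≤₁ ≤₀)
  ≤[]-append-digit {suc (suc x)} {suc m} {suc m'} L x<b _ _ (≤₁ , ≤₀) =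
    ≤-resp-≡ (countLen-nonzero-last b L z<s x<b) (countLen-nonzero-last b L z<s x<b) ≤₁ ,
    ≤-resp-≡ (countLen-nonzero-last b L z<s 1+x<b) (countLen-nonzero-last b L z<s 1+x<b) ≤₁
    where
    1+x<b : suc x < b
    1+x<b = <-trans (n<1+n _) x<b

  ≤[]-lower-last-digit : ∀ {a y} L → 2 ≤ a → a < b → a + b * suc y ≤[ 2 + L ] 1 + b * suc y
  ≤[]-lower-last-digit {y = y} L (s≤s (s≤s _)) a<b =
    ≤-resp-≡ (countLen-nonzero-last b L z<s a<b) (countLen-nonzero-last b L z<s 1<b) ≤-refl ,
    ≤-resp-≡ (countLen-nonzero-last b L z<s (<-trans (n<1+n _) a<b)) (countLen-zero-last b y L)
             (m≤m+n _ _)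

  ≤[]-lower-digit : ∀ i {X a Y} L → X < b ^ i → 2 ≤ a → a < b → 0 < Y →
    X + b ^ i * (a + b * Y) ≤[ suc L ] X + b ^ i * (1 + b * Y)
  ≤[]-lower-digit i       {X} {a} {suc y} zero    _ 2≤a _ _ = ≤[1]-large (begin
    2 + b                       ≤⟨ +-mono-≤ 2≤a (m≤m*n b (suc y)) ⟩
    a + b * suc y               ≤⟨ m≤n*m _ (b ^ i) {{m^n≢0 b i}} ⟩
    b ^ i * (a + b * suc y)     ≤⟨ m≤n+m _ X ⟩
    X + b ^ i * (a + b * suc y) ∎)
    where open ≤-Reasoning
  ≤[]-lower-digit zero    {zero} {Y = suc y} (suc L) _ 2≤a a<b _ =
    subst₂ (_≤[ 2 + L ]_) (sym (*-identityˡ _)) (sym (*-identityˡ _)) (≤[]-lower-last-digit L 2≤a a<b)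
  ≤[]-lower-digit zero    {suc X} (suc L) (s≤s ())
  ≤[]-lower-digit (suc i) {X} {a} {suc y} (suc L) X<b^1+i 2≤a a<b 0<Y =
    subst₂ (_≤[ 2 + L ]_) (sym (split a)) (sym (split 1))
      (≤[]-append-digit L (m%n<n X b) (positive a) (positive 1) (≤[]-lower-digit i L X/b<b^i 2≤a a<b 0<Y))
    where
    split : ∀ c → X + b ^ suc i * (c + b * suc y) ≡ X % b + b * (X / b + b ^ i * (c + b * suc y))
    split c = trans (cong (_+ _) (m≡m%n+[m/n]*n X b)) (split-last-digit (X % b) (X / b) b (b ^ i) _)
    positive : ∀ c → 0 < X / b + b ^ i * (c + b * suc y)
    positive c = begin-strict
      0                               <⟨ >-nonZero⁻¹ b ⟩
      b                               ≤⟨ m≤m*n b (suc y) ⟩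
      b * suc y                       ≤⟨ m≤n+m _ c ⟩
      c + b * suc y                   ≤⟨ m≤n*m _ (b ^ i) {{m^n≢0 b i}} ⟩
      b ^ i * (c + b * suc y)         ≤⟨ m≤n+m _ (X / b) ⟩
      X / b + b ^ i * (c + b * suc y) ∎
      where open ≤-Reasoning
    X/b<b^i : X / b < b ^ i
    X/b<b^i = *-cancelʳ-< b (X / b) (b ^ i)
      (≤-<-trans (m/n*n≤m X b) (subst (X <_) (*-comm b (b ^ i)) X<b^1+i))

  ^-log-unique : ∀ {t k N} → b ^ t ≤ N → N < b ^ suc t → b ^ k ≤ N → N < b ^ suc k → t ≡ k
  ^-log-unique {t} {k} b^t≤N N<b^1+t b^k≤N N<b^1+k with <-cmp t k
  ... | tri< t<k _ _ = contradiction b^k≤N (<⇒≱ (<-≤-trans N<b^1+t (^-monoʳ-≤ b t<k)))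
  ... | tri≈ _ t≡k _ = t≡k
  ... | tri> _ _ k<t = contradiction b^t≤N (<⇒≱ (<-≤-trans N<b^1+k (^-monoʳ-≤ b k<t)))

  b^e+b^e≤b^[1+e] : ∀ e → b ^ e + b ^ e ≤ b ^ suc e
  b^e+b^e≤b^[1+e] e =
    subst (_≤ b * b ^ e) (cong (b ^ e +_) (+-identityʳ (b ^ e))) (*-monoˡ-≤ (b ^ e) 1<b)

  b^k+b^[1+r]≤b^[1+k] : ∀ {k r} → r < k → b ^ k + b ^ suc r ≤ b ^ suc k
  b^k+b^[1+r]≤b^[1+k] {k} r<k = ≤-trans (+-monoʳ-≤ (b ^ k) (^-monoʳ-≤ b r<k)) (b^e+b^e≤b^[1+e] k)

  sumTo-alternate-powers-≤ : ∀ y r → 2 * y ≤ r →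
    sumTo y (λ i → b ^ (r ∸ 2 * i)) + b ^ (r ∸ 2 * y) ≤ b ^ suc r
  sumTo-alternate-powers-≤ zero    r _       = b^e+b^e≤b^[1+e] r
  sumTo-alternate-powers-≤ (suc y) r 2y+2≤r = begin
    (F + b ^ e) + b ^ e ≡⟨ +-assoc F (b ^ e) (b ^ e) ⟩
    F + (b ^ e + b ^ e) ≤⟨ +-monoʳ-≤ F (b^e+b^e≤b^[1+e] e) ⟩
    F + b ^ suc e       ≤⟨ +-monoʳ-≤ F (^-monoʳ-≤ b 1+e≤r∸2y) ⟩
    F + b ^ (r ∸ 2 * y) ≤⟨ sumTo-alternate-powers-≤ y r 2y≤r ⟩
    b ^ suc r           ∎
    where
    open ≤-Reasoning
    F e : ℕ
    F = sumTo y (λ i → b ^ (r ∸ 2 * i))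
    e = r ∸ 2 * suc y
    2y≤r : 2 * y ≤ r
    2y≤r = ≤-trans (*-monoʳ-≤ 2 (n≤1+n y)) 2y+2≤r
    1+e≤r∸2y : suc e ≤ r ∸ 2 * y
    1+e≤r∸2y = ∸-monoʳ-< (*-monoʳ-< 2 (n<1+n y)) 2y+2≤r

  upper<b^k+b^[1+r] : ∀ k {r y} → 2 * y ≤ r → upper b k r y < b ^ k + b ^ suc r
  upper<b^k+b^[1+r] k {r} {y} 2y≤r = +-monoʳ-< (b ^ k)
    (<-≤-trans (m<m+n _ (m^n>0 b (r ∸ 2 * y))) (sumTo-alternate-powers-≤ y r 2y≤r))

  IsNu⇒IsRecord : ∀ {k r y n} → 2 * y ≤ r → IsNu b k r y n →
    b ^ k ≤ n ∸ 1 × n ∸ 1 < b ^ k + b ^ suc r × IsRecord b k (n ∸ 1)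
  IsNu⇒IsRecord {n = zero}        _ ((() , _) , _)
  IsNu⇒IsRecord {k} {n = suc zero} _ ((b^k<1 , _) , _) = contradiction (m^n>0 b k) (<⇒≱ b^k<1)
  IsNu⇒IsRecord {k} {r} {y} {suc (suc N)} 2y≤r ((b^k<n , n≤upper) , _ , least) =
    ≤-pred b^k<n ,
    ≤-<-trans (n≤1+n (suc N)) (≤-<-trans n≤upper (upper<b^k+b^[1+r] k {y = y} 2y≤r)) ,
    isRecord
    where
    isRecord : IsRecord b k (suc N)
    isRecord {suc M} b^k≤M M<N =
      least (suc (suc M)) (s≤s b^k≤M , ≤-trans M<N (≤-trans (n≤1+n _) n≤upper)) (s≤s M<N)
    isRecord {zero}  b^k≤0 _   = contradiction b^k≤0 (<⇒≱ (m^n>0 b k))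

  module RecordExpansion {k r N : ℕ} {a : ℕ → ℕ} (expansion : IsBaseExp b N k a) (1+r<k : suc r < k)
    (b^k≤N : b ^ k ≤ N) (N<b^k+b^[1+r] : N < b ^ k + b ^ suc r) (isRecord : IsRecord b k N) where

    private
      a<b : ∀ {i} → i ≤ k → a i < b
      a<b = proj₁ expansion _

      value≡N : digitsValue b a (suc k) ≡ N
      value≡N = trans (sym (sumTo≡sumBelow k _)) (proj₂ (proj₂ expansion))

    leading-digit≡1 : a k ≡ 1
    leading-digit≡1 = ≤-antisym (≤-pred a[k]<2) (n≢0⇒n>0 (proj₁ (proj₂ expansion)))
      where
      open ≤-Reasoning
      a[k]<2 : a k < 2
      a[k]<2 = *-cancelʳ-< (b ^ k) (a k) 2 (begin-strict
        a k * b ^ k             ≤⟨ term≤digitsValue b a (n<1+n k) ⟩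
        digitsValue b a (suc k) ≡⟨ value≡N ⟩
        N                       <⟨ N<b^k+b^[1+r] ⟩
        b ^ k + b ^ suc r       ≤⟨ +-monoʳ-≤ (b ^ k) (^-monoʳ-≤ b (<⇒≤ 1+r<k)) ⟩
        b ^ k + b ^ k           ≡⟨ cong (b ^ k +_) (+-identityʳ (b ^ k)) ⟨
        2 * b ^ k               ∎)

    lower-digits<b^[1+r] : digitsValue b a k < b ^ suc r
    lower-digits<b^[1+r] = +-cancelʳ-< (b ^ k) (digitsValue b a k) (b ^ suc r) (begin-strict
      digitsValue b a k + b ^ k ≡⟨ cong (digitsValue b a k +_)
                                     (trans (cong (_* b ^ k) leading-digit≡1) (*-identityˡ (b ^ k))) ⟨
      digitsValue b a (suc k)   ≡⟨ value≡N ⟩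
      N                         <⟨ N<b^k+b^[1+r] ⟩
      b ^ k + b ^ suc r         ≡⟨ +-comm (b ^ k) (b ^ suc r) ⟩
      b ^ suc r + b ^ k         ∎)
      where open ≤-Reasoning

    middle-digit≡0 : ∀ j → r < j → j < k → a j ≡ 0
    middle-digit≡0 j r<j j<k = n<1⇒n≡0 (*-cancelʳ-< (b ^ j) (a j) 1 (begin-strict
      a j * b ^ j       ≤⟨ term≤digitsValue b a j<k ⟩
      digitsValue b a k <⟨ lower-digits<b^[1+r] ⟩
      b ^ suc r         ≤⟨ ^-monoʳ-≤ b r<j ⟩
      b ^ j             ≡⟨ *-identityˡ (b ^ j) ⟨
      1 * b ^ j         ∎))
      where open ≤-Reasoning

    cannot-lower-digit : ∀ {i c} (Y : ℕ) → i < k → c < a i →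
      let X = digitsValue b a i in
      N ≡ X + b ^ i * (a i + b * Y) →
      ¬ (0 < Y → X + b ^ i * (a i + b * Y) ≼ X + b ^ i * (c + b * Y))
    cannot-lower-digit {i} {c} Y i<k c<a[i] N≡ dominated =
      <⇒≱ (isRecord b^k≤N' N'<N)
          (countOverExp-≤ (<⇒≤ N'<N) (subst (_≼ N') (sym N≡) (dominated 0<Y)))
      where
      X N' : ℕ
      X  = digitsValue b a i
      N' = X + b ^ i * (c + b * Y)
      N'<N : N' < N
      N'<N = <-≤-trans (+-monoʳ-< X (*-monoʳ-< (b ^ i) {{m^n≢0 b i}} (+-monoˡ-< (b * Y) c<a[i])))
                       (≤-reflexive (sym N≡))
      b^k≡ : b ^ k ≡ b ^ suc i * b ^ (k ∸ suc i)
      b^k≡ = trans (cong (b ^_) (sym (m+[n∸m]≡n i<k))) (^-distribˡ-+-* b (suc i) (k ∸ suc i))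
      low<b^[1+i] : X + a i * b ^ i < b ^ suc i
      low<b^[1+i] = digitsValue-< b a (suc i) λ j<1+i → a<b (≤-trans (≤-pred j<1+i) (<⇒≤ i<k))
      b^[k-1-i]≤Y : b ^ (k ∸ suc i) ≤ Y
      b^[k-1-i]≤Y = m*n≤o+m*p⇒n≤p low<b^[1+i]
        (subst₂ _≤_ b^k≡ (trans N≡ (regroup-digit X (b ^ i) (a i) b Y)) b^k≤N)
      0<Y : 0 < Y
      0<Y = <-≤-trans (m^n>0 b (k ∸ suc i)) b^[k-1-i]≤Y
      b^k≤N' : b ^ k ≤ N'
      b^k≤N' = begin
        b ^ k                           ≡⟨ b^k≡ ⟩
        b ^ suc i * b ^ (k ∸ suc i)     ≤⟨ *-monoʳ-≤ (b ^ suc i) b^[k-1-i]≤Y ⟩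
        b ^ suc i * Y                   ≤⟨ m≤n+m _ _ ⟩
        (X + c * b ^ i) + b ^ suc i * Y ≡⟨ regroup-digit X (b ^ i) c b Y ⟨
        N'                              ∎
        where open ≤-Reasoning

    last-digit≡0 : a 0 ≡ 0
    last-digit≡0 with a 0 ≟ 0
    ... | yes a[0]≡0 = a[0]≡0
    ... | no  a[0]≢0 = contradiction
          (λ 0<Y L → subst₂ (λ M M' → countLen b M (suc L) ≤ countLen b M' (suc L))
            (sym (*-identityˡ _)) (sym (*-identityˡ _)) (countLen-≤-clear-last L 0<a[0] (a<b z≤n) 0<Y))
          (cannot-lower-digit Y (<-trans z<s 1+r<k) 0<a[0] N≡)
      where
      0<a[0] : 0 < a 0
      0<a[0] = n≢0⇒n>0 a[0]≢0
      split : Σ[ Y ∈ ℕ ] digitsValue b a (suc k) ≡ 0 + 1 * (a 0 + b * Y)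
      split = digitsValue-split′ b a (z<s {k})
      Y : ℕ
      Y = proj₁ split
      N≡ : N ≡ 0 + 1 * (a 0 + b * Y)
      N≡ = trans (sym value≡N) (proj₂ split)

    digit≤1 : ∀ i → i ≤ k → a i ≤ 1
    digit≤1 i i≤k with m≤n⇒m<n∨m≡n i≤k | a i ≤? 1
    ... | inj₂ refl | _          = ≤-reflexive leading-digit≡1
    ... | inj₁ _    | yes a[i]≤1 = a[i]≤1
    ... | inj₁ i<k  | no  a[i]≰1 = contradiction
          (λ 0<Y L → proj₁ (≤[]-lower-digit i L lower<b^i (≰⇒> a[i]≰1) (a<b i≤k) 0<Y))
          (cannot-lower-digit Y i<k (≰⇒> a[i]≰1) N≡)
      where
      lower<b^i : digitsValue b a i < b ^ i
      lower<b^i = digitsValue-< b a i λ j<i → a<b (≤-trans (<⇒≤ j<i) i≤k)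
      split : Σ[ Y ∈ ℕ ] digitsValue b a (suc k) ≡ digitsValue b a i + b ^ i * (a i + b * Y)
      split = digitsValue-split′ b a (s≤s i≤k)
      Y : ℕ
      Y = proj₁ split
      N≡ : N ≡ digitsValue b a i + b ^ i * (a i + b * Y)
      N≡ = trans (sym value≡N) (proj₂ split)

lemma10 : (b k r y : ℕ) → 2 ≤ b → 2 * y < r → r < k ∸ 1 →
    (n : ℕ) → IsNu b k r y n →
    (t : ℕ) (a : ℕ → ℕ) → IsBaseExp b (n ∸ 1) t a →
    (t ≡ k) × (a k ≡ 1) × (a 0 ≡ 0) ×
    ((j : ℕ) → r < j → j < k → a j ≡ 0) ×
    ((i : ℕ) → i ≤ k → a i ≤ 1)
lemma10 b k r y 1<b 2y<r r<k∸1 n isNu t a expansion =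
  t≡k , leading-digit≡1 , last-digit≡0 , middle-digit≡0 , digit≤1
  where
  1+r<k : suc r < k
  1+r<k = m<n∸1⇒1+m<n r<k∸1
  facts : b ^ k ≤ n ∸ 1 × n ∸ 1 < b ^ k + b ^ suc r × IsRecord b k (n ∸ 1)
  facts = IsNu⇒IsRecord 1<b {k} {r} {y} {n} (<⇒≤ 2y<r) isNu
  t≡k : t ≡ k
  t≡k = ^-log-unique 1<b (proj₁ (IsBaseExp⇒bounds expansion)) (proj₂ (IsBaseExp⇒bounds expansion))
          (proj₁ facts) (<-≤-trans (proj₁ (proj₂ facts)) (b^k+b^[1+r]≤b^[1+k] 1<b (<⇒≤ 1+r<k)))
  open RecordExpansion 1<b (subst (λ t → IsBaseExp b (n ∸ 1) t a) t≡k expansion) 1+r<k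
    (proj₁ facts) (proj₁ (proj₂ facts)) (proj₂ (proj₂ facts))
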